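{- The value $\phi(\{q\},\mathbb{N}\setminus\{q\})$ does not depend on the positive integer $q$; that is, for every positive integer $q$, $\phi(\{q\},\mathbb{N}\setminus\{q\})=\phi(\{1\},\mathbb{N}\setminus\{1\})$.
   Context: Here $\mathbb{N}=\{1,2,3,\dots\}$ and $[n]=\{1,\dots,n\}$. For $D\subseteq\mathbb{N}$, two permutations $\pi,\sigma$ of $[n]$ are called $G(D)$-different if there is a position $i\in[n]$ with $|\pi(i)-\sigma(i)|\in D$. $T(n,D)$ denotes the maximum cardinality of a set of permutations of $[n]$ any two distinct members of which are $G(D)$-different. For $D\subseteq\mathbb{N}$ with complement $\overline D=\mathbb{N}\setminus D$, the split strength is $$\phi(D,\overline D)=\limsup_{n\to\infty}\frac1n\log_2\frac{T(n,D)\,T(n,\overline D)}{n!}.$$ -}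

module Defs where

open import Data.Nat using (ℕ; zero; suc; _+_; _*_; _^_; _<_; _≤_; ∣_-_∣; _!)

open import Data.Fin using (Fin; toℕ)
open import Data.Fin.Permutation using (Permutation′; _⟨$⟩ʳ_)
open import Data.Integer using (ℤ; +_; -[1+_])
open import Data.Rational using (ℚ; ↥_; ↧ₙ_) renaming (_<_ to _<ℚ_)
open import Data.Product using (Σ; ∃; _×_)
open import Relation.Binary.PropositionalEquality using (_≡_; _≢_)
open import Relation.Nullary using (¬_)

-- A subset D ⊆ ℕ = {1,2,...} is given as a predicate on Agda's ℕ (which
-- contains 0); D is meant to contain only positive numbers.
-- The complement  ℕ \ D  (within the positive integers):
Compl : (ℕ → Set) → (ℕ → Set)
Compl D d = (d ≢ 0) × ¬ D d

Single : ℕ → (ℕ → Set)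
Single q d = d ≡ q

GDiff : ∀ {n} → (ℕ → Set) → Permutation′ n → Permutation′ n → Set
GDiff {n} D π σ = ∃ λ (i : Fin n) → D ∣ toℕ (π ⟨$⟩ʳ i) - toℕ (σ ⟨$⟩ʳ i) ∣

-- A family of k permutations of [n], any two distinct members of which
-- are G(D)-different.  (Distinct indices give G(D)-different, hence
-- distinct, permutations since 0 ∉ D, so k is the cardinality of the set.)
Code : (n : ℕ) → (ℕ → Set) → ℕ → Set
Code n D k = Σ (Fin k → Permutation′ n) λ c →
  ∀ (i j : Fin k) → i ≢ j → GDiff D (c i) (c j)

IsT : ℕ → (ℕ → Set) → ℕ → Set
IsT n D t = Code n D t × (∀ k → Code n D k → k ≤ t)

-- For a positive integer A, a rational r and n ≥ 1:
--   Above A n r   ⇔   (1/n) log₂ (A / n!) > r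
-- with r = a/b (b > 0):  ⇔  A^b > (n!)^b · 2^(a n).
Above : ℕ → ℕ → ℚ → Set
Above A n r with ↥ r
... | + m      = ((n !) ^ (↧ₙ r)) * 2 ^ (m * n) < A ^ (↧ₙ r)
... | -[1+ m ] = (n !) ^ (↧ₙ r) < A ^ (↧ₙ r) * 2 ^ (suc m * n)

InfOften : (ℕ → Set) → Set
InfOften P = ∀ (N : ℕ) → ∃ λ n → N < n × P n

-- For x_n = (1/n) log₂ (a n / n!) and y_n = (1/n) log₂ (b n / n!):
-- limsup x ≤ limsup y (in the extended reals) iff for all rationals r < s,
-- x_n > s infinitely often implies y_n > r infinitely often.
LimsupLe : (ℕ → ℕ) → (ℕ → ℕ) → Set
LimsupLe a b = ∀ (r s : ℚ) → r <ℚ s →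
  InfOften (λ n → Above (a n) n s) → InfOften (λ n → Above (b n) n r)

LimsupEq : (ℕ → ℕ) → (ℕ → ℕ) → Set
LimsupEq a b = LimsupLe a b × LimsupLe b a

-- Let φ be the permutation of [n] that sorts values by their residue mod q and then by their
-- quotient.  Values at distance q are mapped to values at distance 1, and conversely a distance
-- 1 between images comes from a distance q unless the smaller value is one of the top q values
-- of [n].  Relabelling values by φ therefore turns {q}-codes into {1}-codes, and relabelling
-- by φ⁻¹ turns (ℕ∖{1})-codes into (ℕ∖{q})-codes.  In the two remaining directions one first
-- passes, by pigeonhole, to a subcode of at least an n^-q fraction in which all permutations
-- place the top q values at the same positions.  So T(n,{q})T(n,ℕ∖{q}) and T(n,{1})T(n,ℕ∖{1})
-- agree up to a factor n^q, which is invisible in the exponential growth rate.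

module Submission where

open import Defs
open import Data.Fin using (Fin; zero; suc; toℕ; fromℕ; fromℕ<; inject₁; lower₁; punchOut)
import Data.Fin.Properties as Fin
open import Data.Fin.Permutation
  using (Permutation′; permutation; _⟨$⟩ʳ_; _⟨$⟩ˡ_; inverseˡ; inverseʳ; _∘ₚ_; flip)
open import Data.Integer as ℤ using (ℤ; -[1+_])
import Data.Integer.Properties as ℤ
open import Data.List using (List; []; _∷_; length; map; filter; tabulate; lookup; allFin)
open import Data.List.Properties using (length-tabulate; length-map; filter-notAll)
open import Data.List.Membership.Propositional using (_∈_)
open import Data.List.Membership.Propositional.Properties using (∈-allFin; ∈-lookup; ∈-map⁺)
open import Data.List.Relation.Unary.All as All using (All; []; _∷_)
open import Data.List.Relation.Unary.All.Properties
  using (all-filter) renaming (filter⁺ to All-filter⁺)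
open import Data.List.Relation.Unary.AllPairs as AllPairs using (AllPairs; []; _∷_)
open import Data.List.Relation.Unary.AllPairs.Properties
  using (tabulate⁺; map⁺) renaming (filter⁺ to AllPairs-filter⁺)
open import Data.List.Relation.Unary.Any as Any using (Any; here; there)
open import Data.Nat
  using (ℕ; zero; suc; _+_; _*_; _^_; _∸_; _%_; _/_; _!; _⊔_; _≤_; _<_; _≥_; ∣_-_∣;
         z≤n; s≤s; NonZero; >-nonZero)
open import Data.Nat.DivMod
  using (m≡m%n+[m/n]*n; [m+kn]%n≡m%n; [m+n]%n≡m%n; m<n⇒m%n≡m; m%n<n; m/n≤m; m/n*n≤m;
         m/n≡1+[m∸n]/n; /-monoˡ-≤; m*n/n≡m)
open import Data.Nat.Properties
open import Algebra.Properties.CommutativeSemigroup *-commutativeSemigroup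
  using (interchange; x∙yz≈y∙xz)
open import Data.Nat.Tactic.RingSolver using (solve-∀)
open import Data.Product using (∃-syntax; _×_; _,_; proj₁; proj₂; map₂)
open import Data.Rational using (ℚ; ↥_; ↧ₙ_; *<*) renaming (_<_ to _<ℚ_)
open import Data.Sum using (_⊎_; inj₁; inj₂)
open import Function using (_∘_; _on_)
open import Level using (0ℓ)
open import Relation.Binary using (Rel; DecidableEquality; Symmetric)
open import Relation.Binary.Construct.Intersection using (_∩_)
open import Relation.Binary.Definitions using (tri<; tri≈; tri>)
open import Relation.Binary.PropositionalEquality
open import Relation.Nullary using (¬_; yes; no; contradiction)
open import Relation.Unary using (Pred; Decidable; _⊆_)
open import Relation.Unary.Properties using (∁?)

-- Counting and pigeonhole on lists

length-filter+length-filter-∁ : ∀ {A : Set} {P : Pred A 0ℓ} (P? : Decidable P) (xs : List A) →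
  length (filter P? xs) + length (filter (∁? P?) xs) ≡ length xs
length-filter+length-filter-∁ P? [] = refl
length-filter+length-filter-∁ P? (x ∷ xs) with P? x
... | yes _ = cong suc (length-filter+length-filter-∁ P? xs)
... | no _ = trans (+-suc _ _) (cong suc (length-filter+length-filter-∁ P? xs))

module _ {A : Set} {P Q : Pred A 0ℓ} (P? : Decidable P) (Q? : Decidable Q) (P⊆Q : P ⊆ Q) where

  length-filter-mono : ∀ xs → length (filter P? xs) ≤ length (filter Q? xs)
  length-filter-mono [] = z≤n
  length-filter-mono (x ∷ xs) with P? x | Q? x
  ... | yes _  | yes _ = s≤s (length-filter-mono xs)
  ... | yes px | no ¬qx = contradiction (P⊆Q px) ¬qx
  ... | no _   | yes _ = m≤n⇒m≤1+n (length-filter-mono xs)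
  ... | no _   | no _  = length-filter-mono xs

  length-filter-strictMono : ∀ {xs} → Any (λ x → Q x × ¬ P x) xs →
    length (filter P? xs) < length (filter Q? xs)
  length-filter-strictMono {x ∷ xs} (here (qx , ¬px)) with P? x | Q? x
  ... | yes px | _ = contradiction px ¬px
  ... | no _ | yes _ = s≤s (length-filter-mono xs)
  ... | no _ | no ¬qx = contradiction qx ¬qx
  length-filter-strictMono {x ∷ xs} (there any) with P? x | Q? x
  ... | yes _  | yes _ = s≤s (length-filter-strictMono any)
  ... | yes px | no ¬qx = contradiction (P⊆Q px) ¬qx
  ... | no _   | yes _ = m≤n⇒m≤1+n (length-filter-strictMono any)
  ... | no _   | no _  = length-filter-strictMono any

module _ {A : Set} where

  module _ {R : Rel A 0ℓ} {B : Set} (_≟_ : DecidableEquality B) (f : A → B) where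

    private
      SameImage = R ∩ (_≡_ on f)

      fibre-AllPairs : ∀ {k xs} → All (λ x → f x ≡ k) xs → AllPairs R xs → AllPairs SameImage xs
      fibre-AllPairs [] [] = []
      fibre-AllPairs (e ∷ es) (r ∷ rs) =
        All.zipWith (λ (r , e′) → r , trans e (sym e′)) (r , es) ∷ fibre-AllPairs es rs

      ∈-tail : ∀ {y k : B} {ks} → y ∈ k ∷ ks → y ≢ k → y ∈ ks
      ∈-tail (here y≡k) y≢k = contradiction y≡k y≢k
      ∈-tail (there y∈ks) _ = y∈ks

      longer : ∀ {xs ys zs : List A} c → length xs ≤ length ys + c * length zs →
        AllPairs SameImage ys → AllPairs SameImage zs →
        ∃[ ws ] AllPairs SameImage ws × length xs ≤ suc c * length ws
      longer {ys = ys} {zs} c bound rys rzs with ≤-total (length ys) (length zs)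
      ... | inj₁ ys≤zs = zs , rzs , ≤-trans bound (+-monoˡ-≤ _ ys≤zs)
      ... | inj₂ zs≤ys = ys , rys , ≤-trans bound (+-monoʳ-≤ _ (*-monoʳ-≤ c zs≤ys))

    pigeonhole : (ks : List B) (xs : List A) → All (λ x → f x ∈ ks) xs → AllPairs R xs →
      ∃[ ys ] AllPairs (R ∩ (_≡_ on f)) ys × length xs ≤ length ks * length ys
    pigeonhole [] [] _ _ = [] , [] , z≤n
    pigeonhole [] (_ ∷ _) (() ∷ _) _
    pigeonhole (k ∷ ks) xs fxs∈ rxs =
      let ys , rys , |others|≤ = pigeonhole ks others others∈ks (AllPairs-filter⁺ _ rxs)
      in longer {xs = xs} (length ks) (begin
           length xs                           ≡⟨ length-filter+length-filter-∁ (λ x → f x ≟ k) xs ⟨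
           length hits + length others         ≤⟨ +-monoʳ-≤ (length hits) |others|≤ ⟩
           length hits + length ks * length ys ∎)
         (fibre-AllPairs (all-filter _ xs) (AllPairs-filter⁺ _ rxs)) rys
      where
      open ≤-Reasoning
      hits = filter (λ x → f x ≟ k) xs
      others = filter (∁? (λ x → f x ≟ k)) xs
      others∈ks : All (λ x → f x ∈ ks) others
      others∈ks = All.zipWith (λ (m , ne) → ∈-tail m ne) (All-filter⁺ _ fxs∈ , all-filter _ xs)

  pigeonhole-Fin : ∀ {R : Rel A 0ℓ} {n} (f : A → Fin n) (xs : List A) → AllPairs R xs →
    ∃[ ys ] AllPairs (R ∩ (_≡_ on f)) ys × length xs ≤ n * length ys
  pigeonhole-Fin {n = n} f xs rxs =
    map₂ (map₂ (subst (λ m → length xs ≤ m * _) (length-tabulate {n = n} (λ i → i))))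
      (pigeonhole Fin._≟_ f (allFin n) xs (All.universal (λ x → ∈-allFin (f x)) xs) rxs)

  AgreeOn : {K B : Set} → (K → A → B) → List K → Rel A 0ℓ
  AgreeOn κ S a b = All (λ v → κ v a ≡ κ v b) S

  pigeonhole-keys : ∀ {R : Rel A 0ℓ} {K : Set} {n} (κ : K → A → Fin n) (S : List K) (xs : List A) →
    AllPairs R xs →
    ∃[ ys ] AllPairs (R ∩ AgreeOn κ S) ys × length xs ≤ n ^ length S * length ys
  pigeonhole-keys κ [] xs rxs = xs , AllPairs.map (_, []) rxs , ≤-reflexive (sym (+-identityʳ _))
  pigeonhole-keys {n = n} κ (v ∷ S) xs rxs =
    let ys , rys , xs≤ = pigeonhole-keys κ S xs rxs
        zs , rzs , ys≤ = pigeonhole-Fin (κ v) ys rys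
    in zs , AllPairs.map (λ ((r , agree) , e) → r , e ∷ agree) rzs , (begin
         length xs                          ≤⟨ xs≤ ⟩
         n ^ length S * length ys           ≤⟨ *-monoʳ-≤ (n ^ length S) ys≤ ⟩
         n ^ length S * (n * length zs)     ≡⟨ *-assoc (n ^ length S) n (length zs) ⟨
         n ^ length S * n * length zs       ≡⟨ cong (_* length zs) (*-comm (n ^ length S) n) ⟩
         n * n ^ length S * length zs       ∎)
    where open ≤-Reasoning

GDiff-sym : ∀ {n} (D : ℕ → Set) → Symmetric (GDiff {n} D)
GDiff-sym D {π} {σ} (i , d) = i , subst D (∣-∣-comm (toℕ (π ⟨$⟩ʳ i)) _) d

AllPairs-lookup : ∀ {A : Set} {R : Rel A 0ℓ} → Symmetric R → ∀ {xs} → AllPairs R xs →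
  ∀ i j → i ≢ j → R (lookup xs i) (lookup xs j)
AllPairs-lookup R-sym (_ ∷ _) zero zero 0≢0 = contradiction refl 0≢0
AllPairs-lookup R-sym (r ∷ _) zero (suc j) _ = All.lookup r (∈-lookup j)
AllPairs-lookup R-sym (r ∷ _) (suc i) zero _ = R-sym (All.lookup r (∈-lookup i))
AllPairs-lookup R-sym (_ ∷ rs) (suc i) (suc j) i≢j = AllPairs-lookup R-sym rs i j (i≢j ∘ cong suc)

module _ {n : ℕ} where

  Code⇒AllPairs : ∀ {D k} → Code n D k → ∃[ xs ] length xs ≡ k × AllPairs (GDiff D) xs
  Code⇒AllPairs (c , distinct) =
    tabulate c , length-tabulate c , tabulate⁺ (λ {i} {j} → distinct i j)

  AllPairs⇒Code : ∀ {D xs} → AllPairs (GDiff D) xs → Code n D (length xs)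
  AllPairs⇒Code {D} {xs} rxs = lookup xs , AllPairs-lookup (λ {π} {σ} → GDiff-sym D {π} {σ}) rxs

  transfer : ∀ {D D′ k t} {K : Set} (κ : K → Permutation′ n → Fin n) (S : List K)
    (g : Permutation′ n → Permutation′ n) →
    (∀ {π σ} → GDiff D π σ → AgreeOn κ S π σ → GDiff D′ (g π) (g σ)) →
    Code n D k → IsT n D′ t → k ≤ n ^ length S * t
  transfer {D} {D′} {t = t} κ S g preserves code (_ , maximal) with Code⇒AllPairs {D = D} code
  ... | xs , refl , rxs =
    let ys , rys , xs≤ = pigeonhole-keys κ S xs rxs
        g-rys = AllPairs.map (λ {π} {σ} (d , agree) → preserves {π} {σ} d agree) rys
        g-ys = AllPairs⇒Code {D = D′} (map⁺ {R = GDiff D′} {f = g} g-rys)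
    in ≤-trans xs≤ (*-monoʳ-≤ (n ^ length S) (subst (_≤ t) (length-map g ys) (maximal _ g-ys)))

-- Relabelling values by residues

injective⇒surjective : ∀ {n} (f : Fin n → Fin n) → (∀ {u v} → f u ≡ f v → u ≡ v) →
  ∀ p → ∃[ v ] f v ≡ p
injective⇒surjective {suc m} f f-injective p with Fin.any? (λ v → f v Fin.≟ p)
... | yes found = found
... | no ¬found = contradiction (Fin.injective⇒≤ punchOut∘f-injective) (n≮n m)
  where
  p≢f : ∀ v → p ≢ f v
  p≢f v p≡fv = ¬found (v , sym p≡fv)
  punchOut∘f-injective : ∀ {u v} → punchOut (p≢f u) ≡ punchOut (p≢f v) → u ≡ v
  punchOut∘f-injective eq = f-injective (Fin.punchOut-injective (p≢f _) (p≢f _) eq)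

module Ranking {n : ℕ} (κ : Fin n → ℕ) (κ-injective : ∀ {u v} → κ u ≡ κ v → u ≡ v) where

  rank : Fin n → ℕ
  rank v = length (filter (λ w → κ w <? κ v) (allFin n))

  rank<n : ∀ v → rank v < n
  rank<n v = subst (rank v <_) (length-tabulate (λ i → i))
    (filter-notAll (λ w → κ w <? κ v) (allFin n) (Any.map (λ { refl → n≮n (κ v) }) (∈-allFin v)))

  rank-strictMono : ∀ {u v} → κ u < κ v → rank u < rank v
  rank-strictMono {u} {v} κu<κv =
    length-filter-strictMono (λ w → κ w <? κ u) (λ w → κ w <? κ v) (λ κw<κu → <-trans κw<κu κu<κv)
      (Any.map (λ { refl → κu<κv , n≮n (κ u) }) (∈-allFin u))

  rank-cancel-< : ∀ {u v} → rank u < rank v → κ u < κ v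
  rank-cancel-< {u} {v} ru<rv with <-cmp (κ u) (κ v)
  ... | tri< κu<κv _ _ = κu<κv
  ... | tri≈ _ κu≡κv _ =
    contradiction (subst (λ w → rank u < rank w) (sym (κ-injective κu≡κv)) ru<rv) (n≮n _)
  ... | tri> _ _ κv<κu = contradiction ru<rv (<-asym (rank-strictMono κv<κu))

  rank-injective : ∀ {u v} → rank u ≡ rank v → u ≡ v
  rank-injective {u} {v} ru≡rv with <-cmp (κ u) (κ v)
  ... | tri< κu<κv _ _ = contradiction ru≡rv (<⇒≢ (rank-strictMono κu<κv))
  ... | tri≈ _ κu≡κv _ = κ-injective κu≡κv
  ... | tri> _ _ κv<κu = contradiction (sym ru≡rv) (<⇒≢ (rank-strictMono κv<κu))

  relabel : Permutation′ n
  relabel = permutation r (λ p → proj₁ (r-surjective p)) (λ p → proj₂ (r-surjective p))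
    (λ v → r-injective (proj₂ (r-surjective (r v))))
    where
    r : Fin n → Fin n
    r v = fromℕ< (rank<n v)
    r-injective : ∀ {u v} → r u ≡ r v → u ≡ v
    r-injective {u} {v} eq = rank-injective (Fin.fromℕ<-injective _ _ (rank<n u) (rank<n v) eq)
    r-surjective = injective⇒surjective r r-injective

  toℕ-relabel : ∀ v → toℕ (relabel ⟨$⟩ʳ v) ≡ rank v
  toℕ-relabel v = Fin.toℕ-fromℕ< (rank<n v)

  -- A rank strictly between those of v and w is, by surjectivity, the rank of some u, and
  -- then κ v < κ u < κ w.
  rank-suc : ∀ {v w} → κ w ≡ suc (κ v) → rank w ≡ suc (rank v)
  rank-suc {v} {w} κw≡1+κv with m≤n⇒m<n∨m≡n (rank-strictMono (≤-reflexive (sym κw≡1+κv)))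
  ... | inj₂ 1+rv≡rw = sym 1+rv≡rw
  ... | inj₁ 1+rv<rw = contradiction (≤-pred κu<1+κv) (<⇒≱ κv<κu)
    where
    p<n : suc (rank v) < n
    p<n = <-trans 1+rv<rw (rank<n w)
    u = relabel ⟨$⟩ˡ fromℕ< p<n
    ru≡1+rv : rank u ≡ suc (rank v)
    ru≡1+rv = trans (sym (toℕ-relabel u)) (trans (cong toℕ (inverseʳ relabel)) (Fin.toℕ-fromℕ< p<n))
    κv<κu : κ v < κ u
    κv<κu = rank-cancel-< (≤-reflexive (sym ru≡1+rv))
    κu<1+κv : κ u < suc (κ v)
    κu<1+κv = subst (κ u <_) κw≡1+κv (rank-cancel-< (subst (_< rank w) (sym ru≡1+rv) 1+rv<rw))

module _ (q : ℕ) .{{_ : NonZero q}} where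

  -- Residue first, quotient second, so that v and v + q receive consecutive keys.
  residueKey : ∀ {n} → Fin n → ℕ
  residueKey {n} v = toℕ v / q + toℕ v % q * n

  residueKey-injective : ∀ {n} {u v : Fin n} → residueKey u ≡ residueKey v → u ≡ v
  residueKey-injective {n} {u} {v} eq = Fin.toℕ-injective (begin
      toℕ u                   ≡⟨ m≡m%n+[m/n]*n (toℕ u) q ⟩
      toℕ u % q + toℕ u / q * q ≡⟨ cong₂ (λ r d → r + d * q) r≡ d≡ ⟩
      toℕ v % q + toℕ v / q * q ≡⟨ m≡m%n+[m/n]*n (toℕ v) q ⟨
      toℕ v                   ∎)
    where
    open ≡-Reasoning
    instance _ = Fin.nonZeroIndex u
    d<n : ∀ (w : Fin n) → toℕ w / q < n
    d<n w = ≤-<-trans (m/n≤m (toℕ w) q) (Fin.toℕ<n w)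
    key%n : ∀ (w : Fin n) → residueKey w % n ≡ toℕ w / q
    key%n w = trans ([m+kn]%n≡m%n (toℕ w / q) (toℕ w % q) n) (m<n⇒m%n≡m (d<n w))
    d≡ : toℕ u / q ≡ toℕ v / q
    d≡ = trans (sym (key%n u)) (trans (cong (_% n) eq) (key%n v))
    r≡ : toℕ u % q ≡ toℕ v % q
    r≡ = *-cancelʳ-≡ _ _ n
      (+-cancelˡ-≡ (toℕ u / q) _ _ (trans eq (cong (_+ toℕ v % q * n) (sym d≡))))

  residueKey-+q : ∀ {n} {v w : Fin n} → toℕ w ≡ toℕ v + q → residueKey w ≡ suc (residueKey v)
  residueKey-+q {n} {v} {w} w≡v+q = cong₂ (λ d r → d + r * n) d≡ r≡
    where
    r≡ : toℕ w % q ≡ toℕ v % q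
    r≡ = trans (cong (_% q) w≡v+q) ([m+n]%n≡m%n (toℕ v) q)
    d≡ : toℕ w / q ≡ suc (toℕ v / q)
    d≡ = trans (cong (_/ q) w≡v+q)
      (trans (m/n≡1+[m∸n]/n (m≤n+m q (toℕ v))) (cong (λ m → suc (m / q)) (m+n∸n≡m (toℕ v) q)))

  sortByResidue : (n : ℕ) → Permutation′ n
  sortByResidue n = Ranking.relabel (residueKey {n}) residueKey-injective

  sortByResidue-+q : ∀ {n} {v w : Fin n} → toℕ w ≡ toℕ v + q →
    toℕ (sortByResidue n ⟨$⟩ʳ w) ≡ suc (toℕ (sortByResidue n ⟨$⟩ʳ v))
  sortByResidue-+q {n} {v} {w} w≡v+q = begin
      toℕ (sortByResidue n ⟨$⟩ʳ w) ≡⟨ toℕ-relabel w ⟩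
      rank w                       ≡⟨ rank-suc (residueKey-+q w≡v+q) ⟩
      suc (rank v)                 ≡⟨ cong suc (toℕ-relabel v) ⟨
      suc (toℕ (sortByResidue n ⟨$⟩ʳ v)) ∎
    where
    open ≡-Reasoning
    open Ranking (residueKey {n}) residueKey-injective

topValues : (n q : ℕ) → List (Fin n)
topValues (suc n) (suc q) = fromℕ n ∷ map inject₁ (topValues n q)
topValues _ _ = []

length-topValues : ∀ n q → length (topValues n q) ≤ q
length-topValues (suc n) (suc q) =
  s≤s (≤-trans (≤-reflexive (length-map inject₁ (topValues n q))) (length-topValues n q))
length-topValues zero q = z≤n
length-topValues (suc n) zero = z≤n

∈-topValues : ∀ {n q} (v : Fin n) → n ≤ toℕ v + q → v ∈ topValues n q
∈-topValues {suc n} {zero} v n≤v =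
  contradiction (subst (suc n ≤_) (+-identityʳ _) n≤v) (<⇒≱ (Fin.toℕ<n v))
∈-topValues {suc n} {suc q} v n≤v+q with n ≟ toℕ v
... | yes n≡v = here (Fin.toℕ-injective (trans (sym n≡v) (sym (Fin.toℕ-fromℕ n))))
... | no n≢v =
  there (subst (_∈ _) (Fin.inject₁-lower₁ v n≢v) (∈-map⁺ inject₁ (∈-topValues v′ n≤v′+q)))
  where
  v′ = lower₁ v n≢v
  n≤v′+q : n ≤ toℕ v′ + q
  n≤v′+q = subst (λ m → n ≤ m + q) (sym (Fin.toℕ-lower₁ v n≢v))
    (≤-pred (subst (suc n ≤_) (+-suc (toℕ v) q) n≤v+q))

∣m-n∣≡k⇒n≡m+k⊎m≡n+k : ∀ {m n k} → ∣ m - n ∣ ≡ k → n ≡ m + k ⊎ m ≡ n + k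
∣m-n∣≡k⇒n≡m+k⊎m≡n+k {m} {n} refl with ≤-total m n
... | inj₁ m≤n = inj₁ (trans (sym (m+[n∸m]≡n m≤n)) (cong (m +_) (sym (m≤n⇒∣m-n∣≡n∸m m≤n))))
... | inj₂ n≤m = inj₂ (trans (sym (m+[n∸m]≡n n≤m)) (cong (n +_) (sym (m≤n⇒∣n-m∣≡n∸m n≤m))))

n≡m+k⊎m≡n+k⇒∣m-n∣≡k : ∀ {m n k} → n ≡ m + k ⊎ m ≡ n + k → ∣ m - n ∣ ≡ k
n≡m+k⊎m≡n+k⇒∣m-n∣≡k {m} {k = k} (inj₁ refl) = ∣m-m+n∣≡n m k
n≡m+k⊎m≡n+k⇒∣m-n∣≡k {n = n} {k} (inj₂ refl) = trans (∣-∣-comm (n + k) n) (∣m-m+n∣≡n n k)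

module _ {n : ℕ} where

  positionOf : Fin n → Permutation′ n → Fin n
  positionOf v ρ = ρ ⟨$⟩ˡ v

  AgreeOn-positionOf : ∀ {S : List (Fin n)} π σ → AgreeOn positionOf S π σ →
    ∀ i → π ⟨$⟩ʳ i ∈ S → σ ⟨$⟩ʳ i ≡ π ⟨$⟩ʳ i
  AgreeOn-positionOf π σ agree i πi∈S = begin
    σ ⟨$⟩ʳ i                          ≡⟨ cong (σ ⟨$⟩ʳ_) (inverseˡ π) ⟨
    σ ⟨$⟩ʳ (π ⟨$⟩ˡ (π ⟨$⟩ʳ i))        ≡⟨ cong (σ ⟨$⟩ʳ_) (All.lookup agree πi∈S) ⟩
    σ ⟨$⟩ʳ (σ ⟨$⟩ˡ (π ⟨$⟩ʳ i))        ≡⟨ inverseʳ σ ⟩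
    π ⟨$⟩ʳ i                          ∎
    where open ≡-Reasoning

  ⟨$⟩ʳ-injective : ∀ (φ : Permutation′ n) {a b} → φ ⟨$⟩ʳ a ≡ φ ⟨$⟩ʳ b → a ≡ b
  ⟨$⟩ʳ-injective φ {a} {b} eq = trans (sym (inverseˡ φ)) (trans (cong (φ ⟨$⟩ˡ_) eq) (inverseˡ φ))

module Shift {n q : ℕ} (φ : Permutation′ n)
  (φ-+q : ∀ {v w : Fin n} → toℕ w ≡ toℕ v + q → toℕ (φ ⟨$⟩ʳ w) ≡ suc (toℕ (φ ⟨$⟩ʳ v))) where

  private
    ∣_-_∣ᶠ : Fin n → Fin n → ℕ
    ∣ a - b ∣ᶠ = ∣ toℕ a - toℕ b ∣

    ∣-∣ᶠ≡0⇒≡ : ∀ {a b} → ∣ a - b ∣ᶠ ≡ 0 → a ≡ b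
    ∣-∣ᶠ≡0⇒≡ = Fin.toℕ-injective ∘ ∣m-n∣≡0⇒m≡n

    ≡⇒∣-∣ᶠ≡0 : ∀ {a b} → a ≡ b → ∣ a - b ∣ᶠ ≡ 0
    ≡⇒∣-∣ᶠ≡0 = m≡n⇒∣m-n∣≡0 ∘ cong toℕ

    S : List (Fin n)
    S = topValues n q

  ∣-∣≡q⇒∣φ-φ∣≡1 : ∀ {a b} → ∣ a - b ∣ᶠ ≡ q → ∣ φ ⟨$⟩ʳ a - φ ⟨$⟩ʳ b ∣ᶠ ≡ 1
  ∣-∣≡q⇒∣φ-φ∣≡1 ∣a-b∣≡q with ∣m-n∣≡k⇒n≡m+k⊎m≡n+k ∣a-b∣≡q
  ... | inj₁ b≡a+q = n≡m+k⊎m≡n+k⇒∣m-n∣≡k (inj₁ (trans (φ-+q b≡a+q) (+-comm 1 _)))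
  ... | inj₂ a≡b+q = n≡m+k⊎m≡n+k⇒∣m-n∣≡k (inj₂ (trans (φ-+q a≡b+q) (+-comm 1 _)))

  φ-+1⇒+q : ∀ {a b} → toℕ (φ ⟨$⟩ʳ b) ≡ toℕ (φ ⟨$⟩ʳ a) + 1 → (a ∈ S → b ≡ a) →
    toℕ b ≡ toℕ a + q
  φ-+1⇒+q {a} {b} φb≡φa+1 top⇒b≡a with n ≤? toℕ a + q
  ... | yes n≤a+q = contradiction φa+1≡φa (m+1+n≢m _)
    where
    φa+1≡φa = trans (sym φb≡φa+1) (cong (λ c → toℕ (φ ⟨$⟩ʳ c)) (top⇒b≡a (∈-topValues a n≤a+q)))
  ... | no n≰a+q = trans (cong toℕ (sym w≡b)) (Fin.toℕ-fromℕ< a+q<n)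
    where
    a+q<n = ≰⇒> n≰a+q
    w≡b : fromℕ< a+q<n ≡ b
    w≡b = ⟨$⟩ʳ-injective φ (Fin.toℕ-injective
      (trans (φ-+q (Fin.toℕ-fromℕ< a+q<n)) (trans (+-comm 1 _) (sym φb≡φa+1))))

  ∣φ-φ∣≡1⇒∣-∣≡q : ∀ {a b} → ∣ φ ⟨$⟩ʳ a - φ ⟨$⟩ʳ b ∣ᶠ ≡ 1 →
    (a ∈ S → b ≡ a) → (b ∈ S → a ≡ b) → ∣ a - b ∣ᶠ ≡ q
  ∣φ-φ∣≡1⇒∣-∣≡q ∣φa-φb∣≡1 top⇒b≡a top⇒a≡b with ∣m-n∣≡k⇒n≡m+k⊎m≡n+k ∣φa-φb∣≡1
  ... | inj₁ φb≡φa+1 = n≡m+k⊎m≡n+k⇒∣m-n∣≡k (inj₁ (φ-+1⇒+q φb≡φa+1 top⇒b≡a))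
  ... | inj₂ φa≡φb+1 = n≡m+k⊎m≡n+k⇒∣m-n∣≡k (inj₂ (φ-+1⇒+q φa≡φb+1 top⇒a≡b))

  GDiff-q⇒GDiff-1 : ∀ {π σ} → GDiff (Single q) π σ → GDiff (Single 1) (π ∘ₚ φ) (σ ∘ₚ φ)
  GDiff-q⇒GDiff-1 (i , ∣πi-σi∣≡q) = i , ∣-∣≡q⇒∣φ-φ∣≡1 ∣πi-σi∣≡q

  GDiff-∁1⇒GDiff-∁q : ∀ {π σ} → GDiff (Compl (Single 1)) π σ →
    GDiff (Compl (Single q)) (π ∘ₚ flip φ) (σ ∘ₚ flip φ)
  GDiff-∁1⇒GDiff-∁q {π} {σ} (i , ∣πi-σi∣≢0 , ∣πi-σi∣≢1) = i , ≢0 , ≢q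
    where
    a = φ ⟨$⟩ˡ (π ⟨$⟩ʳ i)
    b = φ ⟨$⟩ˡ (σ ⟨$⟩ʳ i)
    unrelabel : ∀ {d} → ∣ φ ⟨$⟩ʳ a - φ ⟨$⟩ʳ b ∣ᶠ ≡ d → ∣ π ⟨$⟩ʳ i - σ ⟨$⟩ʳ i ∣ᶠ ≡ d
    unrelabel = subst₂ (λ x y → ∣ x - y ∣ᶠ ≡ _) (inverseʳ φ) (inverseʳ φ)
    ≢0 : ∣ a - b ∣ᶠ ≢ 0
    ≢0 ∣a-b∣≡0 = ∣πi-σi∣≢0 (unrelabel (≡⇒∣-∣ᶠ≡0 (cong (φ ⟨$⟩ʳ_) (∣-∣ᶠ≡0⇒≡ ∣a-b∣≡0))))
    ≢q : ∣ a - b ∣ᶠ ≢ q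
    ≢q ∣a-b∣≡q = ∣πi-σi∣≢1 (unrelabel (∣-∣≡q⇒∣φ-φ∣≡1 ∣a-b∣≡q))

  GDiff-∁q⇒GDiff-∁1 : ∀ {π σ} → GDiff (Compl (Single q)) π σ → AgreeOn positionOf S π σ →
    GDiff (Compl (Single 1)) (π ∘ₚ φ) (σ ∘ₚ φ)
  GDiff-∁q⇒GDiff-∁1 {π} {σ} (i , ∣πi-σi∣≢0 , ∣πi-σi∣≢q) agree = i , ≢0 , ≢1
    where
    ≢0 : ∣ φ ⟨$⟩ʳ (π ⟨$⟩ʳ i) - φ ⟨$⟩ʳ (σ ⟨$⟩ʳ i) ∣ᶠ ≢ 0
    ≢0 eq = ∣πi-σi∣≢0 (≡⇒∣-∣ᶠ≡0 (⟨$⟩ʳ-injective φ (∣-∣ᶠ≡0⇒≡ eq)))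
    ≢1 : ∣ φ ⟨$⟩ʳ (π ⟨$⟩ʳ i) - φ ⟨$⟩ʳ (σ ⟨$⟩ʳ i) ∣ᶠ ≢ 1
    ≢1 eq = ∣πi-σi∣≢q
      (∣φ-φ∣≡1⇒∣-∣≡q eq (AgreeOn-positionOf π σ agree i)
                        (AgreeOn-positionOf σ π (All.map sym agree) i))

  GDiff-1⇒GDiff-q : ∀ {π σ} → GDiff (Single 1) π σ →
    AgreeOn positionOf S (π ∘ₚ flip φ) (σ ∘ₚ flip φ) → GDiff (Single q) (π ∘ₚ flip φ) (σ ∘ₚ flip φ)
  GDiff-1⇒GDiff-q {π} {σ} (i , ∣πi-σi∣≡1) agree =
    i , ∣φ-φ∣≡1⇒∣-∣≡q (subst₂ (λ x y → ∣ x - y ∣ᶠ ≡ 1) (sym (inverseʳ φ)) (sym (inverseʳ φ)) ∣πi-σi∣≡1)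
                      (AgreeOn-positionOf π′ σ′ agree i)
                      (AgreeOn-positionOf σ′ π′ (All.map sym agree) i)
    where
    π′ = π ∘ₚ flip φ
    σ′ = σ ∘ₚ flip φ

  private
    n^|S|≤n^q : 1 ≤ n → n ^ length S ≤ n ^ q
    n^|S|≤n^q 1≤n = ^-monoʳ-≤ n {{>-nonZero 1≤n}} (length-topValues n q)

  T[q]≤T[1] : ∀ {t s} → IsT n (Single q) t → IsT n (Single 1) s → t ≤ s
  T[q]≤T[1] {s = s} Tq T1 = subst (_ ≤_) (+-identityʳ s)
    (transfer {D = Single q} {Single 1} positionOf [] (_∘ₚ φ)
      (λ {π} {σ} d _ → GDiff-q⇒GDiff-1 {π} {σ} d) (proj₁ Tq) T1)

  T[∁1]≤T[∁q] : ∀ {s t} → IsT n (Compl (Single 1)) s → IsT n (Compl (Single q)) t → s ≤ t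
  T[∁1]≤T[∁q] {t = t} T∁1 T∁q = subst (_ ≤_) (+-identityʳ t)
    (transfer {D = Compl (Single 1)} {Compl (Single q)} positionOf [] (_∘ₚ flip φ)
      (λ {π} {σ} d _ → GDiff-∁1⇒GDiff-∁q {π} {σ} d) (proj₁ T∁1) T∁q)

  T[∁q]≤n^q*T[∁1] : ∀ {t s} → 1 ≤ n → IsT n (Compl (Single q)) t → IsT n (Compl (Single 1)) s →
    t ≤ n ^ q * s
  T[∁q]≤n^q*T[∁1] 1≤n T∁q T∁1 = ≤-trans
    (transfer {D = Compl (Single q)} {Compl (Single 1)} positionOf S (_∘ₚ φ)
      (λ {π} {σ} → GDiff-∁q⇒GDiff-∁1 {π} {σ}) (proj₁ T∁q) T∁1)
    (*-monoˡ-≤ _ (n^|S|≤n^q 1≤n))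

  T[1]≤n^q*T[q] : ∀ {s t} → 1 ≤ n → IsT n (Single 1) s → IsT n (Single q) t → s ≤ n ^ q * t
  T[1]≤n^q*T[q] 1≤n T1 Tq = ≤-trans
    (transfer {D = Single 1} {Single q} (λ v ρ → positionOf v (ρ ∘ₚ flip φ)) S (_∘ₚ flip φ)
      (λ {π} {σ} → GDiff-1⇒GDiff-q {π} {σ}) (proj₁ T1) Tq)
    (*-monoˡ-≤ _ (n^|S|≤n^q 1≤n))

split-products-comparable : ∀ q .{{_ : NonZero q}} {n t₁ t₂ s₁ s₂} → 1 ≤ n →
  IsT n (Single q) t₁ → IsT n (Compl (Single q)) t₂ →
  IsT n (Single 1) s₁ → IsT n (Compl (Single 1)) s₂ →
  t₁ * t₂ ≤ n ^ q * (s₁ * s₂) × s₁ * s₂ ≤ n ^ q * (t₁ * t₂)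
split-products-comparable q {n} {t₁} {t₂} {s₁} {s₂} 1≤n T₁ T₂ S₁ S₂ =
  ≤-trans (*-mono-≤ (T[q]≤T[1] T₁ S₁) (T[∁q]≤n^q*T[∁1] 1≤n T₂ S₂))
    (≤-reflexive (x∙yz≈y∙xz s₁ (n ^ q) s₂)) ,
  ≤-trans (*-mono-≤ (T[1]≤n^q*T[q] 1≤n S₁ T₁) (T[∁1]≤T[∁q] S₂ T₂))
    (≤-reflexive (*-assoc (n ^ q) t₁ t₂))
  where open Shift (sortByResidue q n) (sortByResidue-+q q)

-- Exponential growth rates

n<2^n : ∀ n → n < 2 ^ n
n<2^n zero = s≤s z≤n
n<2^n (suc n) = +-mono-≤ (m^n>0 2 n) (≤-trans (n<2^n n) (m≤m+n (2 ^ n) 0))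

linear≤exp : ∀ a m → a * a + a ≤ m → suc m * a ≤ 2 ^ m
linear≤exp a m a²+a≤m = begin
    suc m * a               ≡⟨ cong (λ x → suc x * a) (m+[n∸m]≡n a≤m) ⟨
    suc (a + k) * a         ≡⟨ lhs a k ⟩
    a + a * k + a * a       ≤⟨ +-monoʳ-≤ (a + a * k) (≤-trans a²≤k (n≤1+n k)) ⟩
    a + a * k + suc k       ≡⟨ rhs a k ⟩
    suc a * suc k           ≤⟨ *-mono-≤ (n<2^n a) (n<2^n k) ⟩
    2 ^ a * 2 ^ k           ≡⟨ ^-distribˡ-+-* 2 a k ⟨
    2 ^ (a + k)             ≡⟨ cong (2 ^_) (m+[n∸m]≡n a≤m) ⟩
    2 ^ m                   ∎
  where
  open ≤-Reasoning
  a≤m = m+n≤o⇒n≤o (a * a) a²+a≤m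
  k = m ∸ a
  a²≤k : a * a ≤ k
  a²≤k = m+n≤o⇒m≤o∸n (a * a) a²+a≤m
  lhs : ∀ a k → suc (a + k) * a ≡ a + a * k + a * a
  lhs = solve-∀
  rhs : ∀ a k → a + a * k + suc k ≡ suc a * suc k
  rhs = solve-∀

poly≤exp-eventually : ∀ L → ∃[ N ] ∀ n → N ≤ n → n ^ L ≤ 2 ^ n
poly≤exp-eventually zero = 0 , λ n _ → m^n>0 2 n
poly≤exp-eventually L@(suc _) = M * L , bound
  where
  M = L * L + L
  bound : ∀ n → M * L ≤ n → n ^ L ≤ 2 ^ n
  bound n ML≤n = begin
      n ^ L             ≤⟨ ^-monoˡ-≤ L n≤[1+m]L ⟩
      (suc m * L) ^ L   ≤⟨ ^-monoˡ-≤ L (linear≤exp L m M≤m) ⟩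
      (2 ^ m) ^ L       ≡⟨ ^-*-assoc 2 m L ⟩
      2 ^ (m * L)       ≤⟨ ^-monoʳ-≤ 2 (m/n*n≤m n L) ⟩
      2 ^ n             ∎
    where
    open ≤-Reasoning
    m = n / L
    M≤m : M ≤ m
    M≤m = subst (_≤ m) (m*n/n≡m M L) (/-monoˡ-≤ L ML≤n)
    n≤[1+m]L : n ≤ suc m * L
    n≤[1+m]L = begin
      n             ≡⟨ m≡m%n+[m/n]*n n L ⟩
      n % L + m * L ≤⟨ +-monoˡ-≤ (m * L) (<⇒≤ (m%n<n n L)) ⟩
      L + m * L     ∎

posPart negPart : ℤ → ℕ
posPart (ℤ.+ m) = m
posPart -[1+ _ ] = 0
negPart (ℤ.+ _) = 0
negPart -[1+ m ] = suc m

-- Above A n r with n ! replaced by F, stated uniformly in the sign of ↥ r.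
Exceeds : (F A n : ℕ) → ℚ → Set
Exceeds F A n r = F ^ ↧ₙ r * 2 ^ (posPart (↥ r) * n) < A ^ ↧ₙ r * 2 ^ (negPart (↥ r) * n)

Above⇒Exceeds : ∀ {A n} r → Above A n r → Exceeds (n !) A n r
Above⇒Exceeds {A} {n} r above with ↥ r
... | ℤ.+ m = subst ((n !) ^ ↧ₙ r * 2 ^ (m * n) <_) (sym (*-identityʳ (A ^ ↧ₙ r))) above
... | -[1+ m ] = subst (_< A ^ ↧ₙ r * 2 ^ (suc m * n)) (sym (*-identityʳ ((n !) ^ ↧ₙ r))) above

Exceeds⇒Above : ∀ {A n} r → Exceeds (n !) A n r → Above A n r
Exceeds⇒Above {A} {n} r exceeds with ↥ r
... | ℤ.+ m = subst ((n !) ^ ↧ₙ r * 2 ^ (m * n) <_) (*-identityʳ (A ^ ↧ₙ r)) exceeds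
... | -[1+ m ] = subst (_< A ^ ↧ₙ r * 2 ^ (suc m * n)) (*-identityʳ ((n !) ^ ↧ₙ r)) exceeds

posPart-negPart-< : ∀ x y k l → x ℤ.* ℤ.+ suc k ℤ.< y ℤ.* ℤ.+ suc l →
  posPart x * suc k + negPart y * suc l < posPart y * suc l + negPart x * suc k
posPart-negPart-< (ℤ.+ a) (ℤ.+ b) k l x<y
  rewrite ℤ.+◃n≡+n (a * suc k) | ℤ.+◃n≡+n (b * suc l) with x<y
... | ℤ.+<+ ak<bl = subst₂ _<_ (sym (+-identityʳ _)) (sym (+-identityʳ _)) ak<bl
posPart-negPart-< (ℤ.+ a) -[1+ b ] k l x<y rewrite ℤ.+◃n≡+n (a * suc k) with x<y
... | ()
posPart-negPart-< -[1+ a ] (ℤ.+ b) k l _ = ≤-trans (s≤s z≤n) (m≤n+m (suc k + a * suc k) (b * suc l))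
posPart-negPart-< -[1+ a ] -[1+ b ] k l (ℤ.-<- bl<ak) = s≤s bl<ak

^-distribʳ-* : ∀ m n k → (m * n) ^ k ≡ m ^ k * n ^ k
^-distribʳ-* m n zero = refl
^-distribʳ-* m n (suc k) = begin
    m * n * (m * n) ^ k     ≡⟨ cong (m * n *_) (^-distribʳ-* m n k) ⟩
    m * n * (m ^ k * n ^ k) ≡⟨ interchange m n (m ^ k) (n ^ k) ⟩
    m * m ^ k * (n * n ^ k) ∎
  where open ≡-Reasoning

^-cancelʳ-< : ∀ {m n} k → m ^ k < n ^ k → m < n
^-cancelʳ-< {m} {n} k mᵏ<nᵏ = ≰⇒> (λ n≤m → <⇒≱ mᵏ<nᵏ (^-monoˡ-≤ k n≤m))

scaled-power : ∀ x a u k → (x ^ a * 2 ^ u) ^ k ≡ x ^ (a * k) * 2 ^ (u * k)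
scaled-power x a u k =
  trans (^-distribʳ-* (x ^ a) (2 ^ u) k) (cong₂ _*_ (^-*-assoc x a k) (^-*-assoc 2 u k))

trade-powers-of-2 : ∀ {X Y Z u v w u′ v′} → X * 2 ^ u < Y * 2 ^ v → Y ≤ Z * 2 ^ w →
  u′ + v + w ≤ v′ + u → X * 2 ^ u′ < Z * 2 ^ v′
trade-powers-of-2 {X} {Y} {Z} {u} {v} {w} {u′} {v′} X2ᵘ<Y2ᵛ Y≤Z2ʷ exponents =
  *-cancelʳ-< (2 ^ u) _ _ (begin-strict
    X * 2 ^ u′ * 2 ^ u          ≡⟨ swap X (2 ^ u′) (2 ^ u) ⟩
    X * 2 ^ u * 2 ^ u′          <⟨ *-monoˡ-< (2 ^ u′) {{m^n≢0 2 u′}} X2ᵘ<Y2ᵛ ⟩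
    Y * 2 ^ v * 2 ^ u′          ≤⟨ *-monoˡ-≤ (2 ^ u′) (*-monoˡ-≤ (2 ^ v) Y≤Z2ʷ) ⟩
    Z * 2 ^ w * 2 ^ v * 2 ^ u′  ≡⟨ rearrange Z (2 ^ w) (2 ^ v) (2 ^ u′) ⟩
    Z * (2 ^ u′ * 2 ^ v * 2 ^ w) ≡⟨ cong (Z *_) (2^[a+b+c] u′ v w) ⟨
    Z * 2 ^ (u′ + v + w)        ≤⟨ *-monoʳ-≤ Z (^-monoʳ-≤ 2 exponents) ⟩
    Z * 2 ^ (v′ + u)            ≡⟨ cong (Z *_) (^-distribˡ-+-* 2 v′ u) ⟩
    Z * (2 ^ v′ * 2 ^ u)        ≡⟨ *-assoc Z (2 ^ v′) (2 ^ u) ⟨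
    Z * 2 ^ v′ * 2 ^ u          ∎)
  where
  open ≤-Reasoning
  swap : ∀ x a b → x * a * b ≡ x * b * a
  swap = solve-∀
  rearrange : ∀ z a b c → z * a * b * c ≡ z * (c * b * a)
  rearrange = solve-∀
  2^[a+b+c] : ∀ a b c → 2 ^ (a + b + c) ≡ 2 ^ a * 2 ^ b * 2 ^ c
  2^[a+b+c] a b c = trans (^-distribˡ-+-* 2 (a + b) c) (cong (_* 2 ^ c) (^-distribˡ-+-* 2 a b))

-- Raise to the power ↧ₙ r · ↧ₙ s to clear denominators; then r < s leaves a spare factor 2ⁿ.
Exceeds-weaken : ∀ {F A B n} r s → r <ℚ s → A ^ (↧ₙ s * ↧ₙ r) ≤ B ^ (↧ₙ s * ↧ₙ r) * 2 ^ n →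
  Exceeds F A n s → Exceeds F B n r
Exceeds-weaken {F} {A} {B} {n} r s (*<* r<s) Aᴱ≤Bᴱ2ⁿ exceeds = ^-cancelʳ-< bs (subst₂ _<_
    (trans (cong (λ E → F ^ E * 2 ^ (Pr * n * bs)) (*-comm bs br))
           (sym (scaled-power F br (Pr * n) bs)))
    (trans (cong (λ E → B ^ E * 2 ^ (Mr * n * bs)) (*-comm bs br))
           (sym (scaled-power B br (Mr * n) bs)))
    traded)
  where
  br = ↧ₙ r
  bs = ↧ₙ s
  Pr = posPart (↥ r)
  Mr = negPart (↥ r)
  Ps = posPart (↥ s)
  Ms = negPart (↥ s)
  raised : F ^ (bs * br) * 2 ^ (Ps * n * br) < A ^ (bs * br) * 2 ^ (Ms * n * br)
  raised = subst₂ _<_ (scaled-power F bs (Ps * n) br) (scaled-power A bs (Ms * n) br)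
    (^-monoˡ-< br exceeds)
  exponents : Pr * n * bs + Ms * n * br + n ≤ Mr * n * bs + Ps * n * br
  exponents = begin
    Pr * n * bs + Ms * n * br + n ≡⟨ lhs Pr Ms n bs br ⟩
    suc (Pr * bs + Ms * br) * n   ≤⟨ *-monoˡ-≤ n (posPart-negPart-< (↥ r) (↥ s) _ _ r<s) ⟩
    (Ps * br + Mr * bs) * n       ≡⟨ rhs Ps Mr n bs br ⟩
    Mr * n * bs + Ps * n * br     ∎
    where
    open ≤-Reasoning
    lhs : ∀ p m n b b′ → p * n * b + m * n * b′ + n ≡ suc (p * b + m * b′) * n
    lhs = solve-∀
    rhs : ∀ p m n b b′ → (p * b′ + m * b) * n ≡ m * n * b + p * n * b′
    rhs = solve-∀
  traded : F ^ (bs * br) * 2 ^ (Pr * n * bs) < B ^ (bs * br) * 2 ^ (Mr * n * bs)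
  traded = trade-powers-of-2
    {F ^ (bs * br)} {A ^ (bs * br)} {B ^ (bs * br)} {Ps * n * br} {Ms * n * br} {n}
    raised Aᴱ≤Bᴱ2ⁿ exponents

power-of-poly-bound : ∀ {a b n c} E → a ≤ n ^ c * b → n ^ (c * E) ≤ 2 ^ n → a ^ E ≤ b ^ E * 2 ^ n
power-of-poly-bound {a} {b} {n} {c} E a≤nᶜb nᶜᴱ≤2ⁿ = begin
  a ^ E                 ≤⟨ ^-monoˡ-≤ E a≤nᶜb ⟩
  (n ^ c * b) ^ E       ≡⟨ ^-distribʳ-* (n ^ c) b E ⟩
  (n ^ c) ^ E * b ^ E   ≡⟨ cong (_* b ^ E) (^-*-assoc n c E) ⟩
  n ^ (c * E) * b ^ E   ≤⟨ *-monoˡ-≤ (b ^ E) nᶜᴱ≤2ⁿ ⟩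
  2 ^ n * b ^ E         ≡⟨ *-comm (2 ^ n) (b ^ E) ⟩
  b ^ E * 2 ^ n         ∎
  where open ≤-Reasoning

LimsupLe-of-poly-bound : ∀ (a b : ℕ → ℕ) c → (∀ n → 1 ≤ n → a n ≤ n ^ c * b n) → LimsupLe a b
LimsupLe-of-poly-bound a b c a≤nᶜb r s r<s often N
  with N₀ , nᶜᴱ≤2ⁿ ← poly≤exp-eventually (c * (↧ₙ s * ↧ₙ r))
  with n , N⊔N₀<n , above ← often (N ⊔ N₀)
  = n , ≤-<-trans (m≤m⊔n N N₀) N⊔N₀<n ,
    Exceeds⇒Above r (Exceeds-weaken {n !} {a n} {b n} {n} r s r<s
      (power-of-poly-bound {a n} {b n} {n} {c} (↧ₙ s * ↧ₙ r) (a≤nᶜb n (≤-<-trans z≤n N⊔N₀<n))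
        (nᶜᴱ≤2ⁿ n (≤-trans (m≤n⊔m N N₀) (<⇒≤ N⊔N₀<n))))
      (Above⇒Exceeds s above))

proposition3 : ∀ (q : ℕ) → q ≥ 1 →
    ∀ (t₁ t₂ s₁ s₂ : ℕ → ℕ) →
    (∀ n → IsT n (Single q) (t₁ n)) →
    (∀ n → IsT n (Compl (Single q)) (t₂ n)) →
    (∀ n → IsT n (Single 1) (s₁ n)) →
    (∀ n → IsT n (Compl (Single 1)) (s₂ n)) →
    LimsupEq (λ n → t₁ n * t₂ n) (λ n → s₁ n * s₂ n)
proposition3 q q≥1 t₁ t₂ s₁ s₂ T₁ T₂ S₁ S₂ =
  LimsupLe-of-poly-bound _ _ q (λ n 1≤n → proj₁ (comparable n 1≤n)) ,
  LimsupLe-of-poly-bound _ _ q (λ n 1≤n → proj₂ (comparable n 1≤n))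
  where
  instance _ = >-nonZero q≥1
  comparable : ∀ n → 1 ≤ n →
    t₁ n * t₂ n ≤ n ^ q * (s₁ n * s₂ n) × s₁ n * s₂ n ≤ n ^ q * (t₁ n * t₂ n)
  comparable n 1≤n = split-products-comparable q 1≤n (T₁ n) (T₂ n) (S₁ n) (S₂ n)
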